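{- Let $G$ be a connected $\{K_{1,3},Z_{2}\}$-free graph which contains $N$ as an induced subgraph. Then $G$ is a pointed generalized comb.
   Context: All graphs are finite and simple. A graph is $\mathcal{F}$-free if it contains no member of $\mathcal{F}$ as an induced subgraph. $K_{1,3}$ is the star with three leaves. $Z_2$ is obtained from a triangle $abc$ by adding a path $ade$ with new vertices $d,e$. $N$ is obtained from a triangle $abc$ by adding three new vertices, one adjacent only to $a$, one only to $b$, one only to $c$. Generalized comb: let $m\geq 3$; let $L_{1},\dots,L_{m}$ and $C$ be pairwise vertex-disjoint nonempty cliques with $|C|\geq m$, and let $R_{1},\dots,R_{m}$ be pairwise disjoint nonempty subsets of $C$. The generalized comb is the graph on $L_{1}\cup\dots\cup L_{m}\cup C$ in which each $L_i$ and $C$ are cliques, every vertex of $L_i$ is adjacent to every vertex of $R_i$, and there are no other edges. It is pointed if $|L_i|=1$ for all $i$. -}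

module Defs where

open import Data.Nat using (ℕ; _≤_)
open import Data.Fin using (Fin; zero; suc; _≟_)
open import Data.Bool using (Bool; true; false; _∨_; _∧_)
open import Data.Bool.Properties using (∨-comm)
open import Data.List using (List; []; _∷_)
open import Data.Bool.ListAction using (any)
open import Data.Product using (Σ; ∃; _×_; _,_)
open import Data.Sum using (_⊎_)
open import Relation.Nullary using (¬_)
open import Relation.Nullary.Decidable using (⌊_⌋)
open import Relation.Binary.PropositionalEquality using (_≡_; _≢_; refl)
open import Function.Definitions using (Injective)
open import Function.Bundles using (_⇔_)

record Graph : Set where
  field
    n     : ℕ
    adj   : Fin n → Fin n → Bool
    sym   : ∀ u v → adj u v ≡ adj v u
    irref : ∀ v → adj v v ≡ false
open Graph public

record InducedSub (H G : Graph) : Set where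
  field
    emb     : Fin (n H) → Fin (n G)
    emb-inj : Injective _≡_ _≡_ emb
    emb-adj : ∀ u v → adj G (emb u) (emb v) ≡ adj H u v

Contains : Graph → Graph → Set
Contains G H = InducedSub H G

Free : Graph → Graph → Set
Free G H = ¬ Contains G H

data Reach (G : Graph) : Fin (n G) → Fin (n G) → Set where
  here : ∀ {u} → Reach G u u
  step : ∀ {u v w} → adj G u v ≡ true → Reach G v w → Reach G u w

Connected : Graph → Set
Connected G = ∀ u v → Reach G u v

private
  eqP : ∀ {k} → Fin k × Fin k → Fin k → Fin k → Bool
  eqP (a , b) i j = ⌊ a ≟ i ⌋ ∧ ⌊ b ≟ j ⌋

edgesAdj : ∀ {k} → List (Fin k × Fin k) → Fin k → Fin k → Bool
edgesAdj es i j = any (λ e → eqP e i j) es ∨ any (λ e → eqP e j i) es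

edgesAdj-sym : ∀ {k} (es : List (Fin k × Fin k)) u v → edgesAdj es u v ≡ edgesAdj es v u
edgesAdj-sym es u v = ∨-comm (any (λ e → eqP e u v) es) (any (λ e → eqP e v u) es)

K13 : Graph
K13 = record
  { n = 4
  ; adj = edgesAdj es
  ; sym = edgesAdj-sym es
  ; irref = λ { zero → refl ; (suc zero) → refl ; (suc (suc zero)) → refl
              ; (suc (suc (suc zero))) → refl } }
  where
  es : List (Fin 4 × Fin 4)
  es = (zero , suc zero) ∷ (zero , suc (suc zero)) ∷ (zero , suc (suc (suc zero))) ∷ []

Z2 : Graph
Z2 = record
  { n = 5
  ; adj = edgesAdj es
  ; sym = edgesAdj-sym es
  ; irref = λ { zero → refl ; (suc zero) → refl ; (suc (suc zero)) → refl
              ; (suc (suc (suc zero))) → refl ; (suc (suc (suc (suc zero)))) → refl } }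
  where
  a b c d e : Fin 5
  a = zero
  b = suc zero
  c = suc (suc zero)
  d = suc (suc (suc zero))
  e = suc (suc (suc (suc zero)))
  es : List (Fin 5 × Fin 5)
  es = (a , b) ∷ (b , c) ∷ (a , c) ∷ (a , d) ∷ (d , e) ∷ []

NetG : Graph
NetG = record
  { n = 6
  ; adj = edgesAdj es
  ; sym = edgesAdj-sym es
  ; irref = λ { zero → refl ; (suc zero) → refl ; (suc (suc zero)) → refl
              ; (suc (suc (suc zero))) → refl ; (suc (suc (suc (suc zero)))) → refl
              ; (suc (suc (suc (suc (suc zero))))) → refl } }
  where
  a b c x y z : Fin 6
  a = zero
  b = suc zero
  c = suc (suc zero)
  x = suc (suc (suc zero))
  y = suc (suc (suc (suc zero)))
  z = suc (suc (suc (suc (suc zero))))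
  es : List (Fin 6 × Fin 6)
  es = (a , b) ∷ (b , c) ∷ (a , c) ∷ (a , x) ∷ (b , y) ∷ (c , z) ∷ []

-- G is (isomorphic to) a pointed generalized comb: its vertex set is
-- the disjoint union of m ≥ 3 singleton cliques L_i = {leaf i} and a
-- clique C with |C| ≥ m, with pairwise disjoint nonempty R_i ⊆ C such
-- that leaf i is adjacent exactly to R_i, and no other edges.
record PointedGenComb (G : Graph) : Set₁ where
  field
    m        : ℕ
    m≥3      : 3 ≤ m
    leaf     : Fin m → Fin (n G)
    leaf-inj : Injective _≡_ _≡_ leaf
    C        : Fin (n G) → Set
    R        : Fin m → Fin (n G) → Set
    cover    : ∀ v → C v ⊎ ∃ λ i → v ≡ leaf i
    leaf∉C   : ∀ i → ¬ C (leaf i)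
    C-size   : Σ (Fin m → Fin (n G)) λ g → Injective _≡_ _≡_ g × (∀ j → C (g j))
    R⊆C      : ∀ i v → R i v → C v
    R-ne     : ∀ i → ∃ λ v → R i v
    R-disj   : ∀ i j v → R i v → R j v → i ≡ j
    C-clique : ∀ u v → C u → C v → u ≢ v → adj G u v ≡ true
    L-indep  : ∀ i j → i ≢ j → adj G (leaf i) (leaf j) ≡ false
    L-C      : ∀ i v → C v → (adj G (leaf i) v ≡ true ⇔ R i v)

-- Fix an induced net: triangle a b c with pendants x y z.  Claw- and
-- Z₂-freeness force every vertex outside the "core" (the vertices equal or
-- adjacent to all of a, b, c) to be either a pendant or far from the
-- triangle, and connectivity forces every neighbour of a far vertex into the
-- core.  Hence the non-core vertices form an independent set (the leaves),
-- the core is a clique, and no core vertex has two leaf neighbours; so the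
-- neighbourhoods of the leaves in the core are the disjoint sets R_i.
module Submission where

open import Defs hiding (sym)
open import Data.Nat using (_≤_)
open import Data.Fin using (Fin; zero; suc; _≟_)
open import Data.Fin.Patterns using (0F; 1F; 2F; 3F; 4F; 5F)
open import Data.Fin.Properties using (all?; injective⇒≤)
open import Data.Bool using (true; false)
open import Data.Bool.Properties using (¬-not) renaming (_≟_ to _≟ᵇ_)
open import Data.List using (List; _∷_; length; lookup; filter; allFin)
open import Data.List.Relation.Unary.Unique.Propositional using (Unique)
open import Data.List.Relation.Unary.Unique.Propositional.Properties using (filter⁺; allFin⁺)
open import Data.List.Relation.Unary.AllPairs.Core using (_∷_)
import Data.List.Relation.Unary.All as All
open import Data.List.Relation.Unary.Any using (index)
open import Data.List.Relation.Unary.Any.Properties using (lookup-index)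
open import Data.List.Membership.Propositional using (_∈_)
open import Data.List.Membership.Propositional.Properties using (∈-lookup; ∈-filter⁺; ∈-filter⁻; ∈-allFin)
open import Data.Product using (∃; _×_; _,_; proj₁; proj₂)
open import Data.Sum using (_⊎_; inj₁; inj₂)
open import Data.Empty using (⊥; ⊥-elim)
open import Function using (_∘_)
open import Relation.Nullary using (¬_; Dec; yes; no; ¬?)
open import Relation.Nullary.Decidable using (_×-dec_; _⊎-dec_; _→-dec_; toWitness)
open import Relation.Binary.PropositionalEquality using (_≡_; _≢_; refl; sym; trans; cong; subst; module ≡-Reasoning)
open import Function.Definitions using (Injective)
open import Function.Bundles using (mk⇔)

lookup-injective : ∀ {A : Set} {xs : List A} → Unique xs → Injective _≡_ _≡_ (lookup xs)
lookup-injective {xs = _ ∷ _} (_ ∷ _) {zero} {zero} _ = refl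
lookup-injective {xs = _ ∷ _} (x∉xs ∷ _) {zero} {suc j} e = ⊥-elim (All.lookup x∉xs (∈-lookup j) e)
lookup-injective {xs = _ ∷ _} (x∉xs ∷ _) {suc i} {zero} e = ⊥-elim (All.lookup x∉xs (∈-lookup i) (sym e))
lookup-injective {xs = _ ∷ _} (_ ∷ u) {suc i} {suc j} e = cong suc (lookup-injective u e)

distinct⇒injective : ∀ {k} {B : Set} (f : Fin k → B) → (∀ i j → i ≢ j → f i ≢ f j) → Injective _≡_ _≡_ f
distinct⇒injective f distinct {i} {j} e with i ≟ j
... | yes i≡j = i≡j
... | no i≢j = ⊥-elim (distinct i j i≢j e)

Twins : (H : Graph) → Fin (n H) → Fin (n H) → Set
Twins H i j = ∀ k → adj H i k ≡ adj H j k

TwinFree : Graph → Set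
TwinFree H = ∀ i j → Twins H i j → i ≡ j

twinFree? : ∀ H → Dec (TwinFree H)
twinFree? H = all? λ i → all? λ j → all? (λ k → adj H i k ≟ᵇ adj H j k) →-dec i ≟ j

Z2-twinFree : TwinFree Z2
Z2-twinFree = toWitness {a? = twinFree? Z2} _

module Adjacency (G : Graph) where

  V : Set
  V = Fin (n G)

  infix 4 _~_ _≁_
  _~_ _≁_ : V → V → Set
  u ~ v = adj G u v ≡ true
  u ≁ v = adj G u v ≡ false

  variable
    u v w p q r t : V

  ~-sym : u ~ v → v ~ u
  ~-sym {u} {v} u~v = trans (Graph.sym G v u) u~v

  ≁-sym : u ≁ v → v ≁ u
  ≁-sym {u} {v} u≁v = trans (Graph.sym G v u) u≁v

  ~⇒¬≁ : u ~ v → ¬ u ≁ v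
  ~⇒¬≁ u~v u≁v with () ← trans (sym u~v) u≁v

  ¬≁⇒~ : ¬ u ≁ v → u ~ v
  ¬≁⇒~ {u} {v} ¬u≁v with adj G u v
  ... | true = refl
  ... | false = ⊥-elim (¬u≁v refl)

  ¬~⇒≁ : ¬ u ~ v → u ≁ v
  ¬~⇒≁ ¬u~v = ¬-not ¬u~v

  ~-irrefl : u ~ v → u ≢ v
  ~-irrefl {u} u~v refl = ~⇒¬≁ u~v (irref G u)

  ~≁⇒≢ : w ~ u → w ≁ v → u ≢ v
  ~≁⇒≢ w~u w≁v refl = ~⇒¬≁ w~u w≁v

  ≁~⇒≢ : w ≁ u → w ~ v → u ≢ v
  ≁~⇒≢ w≁u w~v u≡v = ~≁⇒≢ w~v w≁u (sym u≡v)

  Near Apart : V → V → Set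
  Near s v = v ≡ s ⊎ s ~ v
  Apart s v = v ≢ s × s ≁ v

  near? : ∀ s v → Dec (Near s v)
  near? s v = v ≟ s ⊎-dec (adj G s v ≟ᵇ true)

  near-or-apart : ∀ s v → Near s v ⊎ Apart s v
  near-or-apart s v with near? s v
  ... | yes near = inj₁ near
  ... | no ¬near = inj₂ (¬near ∘ inj₁ , ¬~⇒≁ (¬near ∘ inj₂))

  near⇒~ : ∀ {s} → Near s v → v ≢ s → s ~ v
  near⇒~ (inj₁ v≡s) v≢s = ⊥-elim (v≢s v≡s)
  near⇒~ (inj₂ s~v) _ = s~v

  apart⇒¬near : ∀ {s} → Apart s v → ¬ Near s v
  apart⇒¬near (v≢s , _) (inj₁ v≡s) = v≢s v≡s
  apart⇒¬near (_ , s≁v) (inj₂ s~v) = ~⇒¬≁ s~v s≁v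

  copy-twins : ∀ {H} (f : Fin (n H) → V) → (∀ i j → adj G (f i) (f j) ≡ adj H i j) →
               ∀ {i j} → f i ≡ f j → Twins H i j
  copy-twins {H} f preserves {i} {j} fi≡fj k = begin
    adj H i k          ≡⟨ sym (preserves i k) ⟩
    adj G (f i) (f k)  ≡⟨ cong (λ s → adj G s (f k)) fi≡fj ⟩
    adj G (f j) (f k)  ≡⟨ preserves j k ⟩
    adj H j k          ∎
    where open ≡-Reasoning

  induced-copy : ∀ {H} → TwinFree H → (f : Fin (n H) → V) →
                 (∀ i j → adj G (f i) (f j) ≡ adj H i j) → Contains G H
  induced-copy {H} twinFree f preserves = record
    { emb = f
    ; emb-inj = λ {i} {j} e → twinFree i j (copy-twins {H} f preserves e)
    ; emb-adj = preserves }

  -- The leaves of K₁,₃ are twins, so unlike for Z₂ their distinctness must be assumed.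
  induced-claw : w ~ p → w ~ q → w ~ r → p ≁ q → p ≁ r → q ≁ r →
                 p ≢ q → p ≢ r → q ≢ r → Contains G K13
  induced-claw {w} {p} {q} {r} w~p w~q w~r p≁q p≁r q≁r p≢q p≢r q≢r = record
    { emb = f ; emb-inj = distinct⇒injective f distinct ; emb-adj = preserves }
    where
    f : Fin 4 → V
    f 0F = w
    f 1F = p
    f 2F = q
    f 3F = r
    preserves : ∀ i j → adj G (f i) (f j) ≡ adj K13 i j
    preserves 0F 0F = irref G w
    preserves 0F 1F = w~p
    preserves 0F 2F = w~q
    preserves 0F 3F = w~r
    preserves 1F 0F = ~-sym w~p
    preserves 1F 1F = irref G p
    preserves 1F 2F = p≁q
    preserves 1F 3F = p≁r
    preserves 2F 0F = ~-sym w~q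
    preserves 2F 1F = ≁-sym p≁q
    preserves 2F 2F = irref G q
    preserves 2F 3F = q≁r
    preserves 3F 0F = ~-sym w~r
    preserves 3F 1F = ≁-sym p≁r
    preserves 3F 2F = ≁-sym q≁r
    preserves 3F 3F = irref G r
    distinct : ∀ i j → i ≢ j → f i ≢ f j
    distinct 0F 0F i≢j = ⊥-elim (i≢j refl)
    distinct 0F 1F _ = ~-irrefl w~p
    distinct 0F 2F _ = ~-irrefl w~q
    distinct 0F 3F _ = ~-irrefl w~r
    distinct 1F 0F _ = ~-irrefl w~p ∘ sym
    distinct 1F 1F i≢j = ⊥-elim (i≢j refl)
    distinct 1F 2F _ = p≢q
    distinct 1F 3F _ = p≢r
    distinct 2F 0F _ = ~-irrefl w~q ∘ sym
    distinct 2F 1F _ = p≢q ∘ sym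
    distinct 2F 2F i≢j = ⊥-elim (i≢j refl)
    distinct 2F 3F _ = q≢r
    distinct 3F 0F _ = ~-irrefl w~r ∘ sym
    distinct 3F 1F _ = p≢r ∘ sym
    distinct 3F 2F _ = q≢r ∘ sym
    distinct 3F 3F i≢j = ⊥-elim (i≢j refl)

  induced-Z2 : p ~ q → q ~ r → p ~ r → p ~ t → t ~ u →
               q ≁ t → r ≁ t → p ≁ u → q ≁ u → r ≁ u → Contains G Z2
  induced-Z2 {p} {q} {r} {t} {u} p~q q~r p~r p~t t~u q≁t r≁t p≁u q≁u r≁u =
    induced-copy Z2-twinFree f preserves
    where
    f : Fin 5 → V
    f 0F = p
    f 1F = q
    f 2F = r
    f 3F = t
    f 4F = u
    preserves : ∀ i j → adj G (f i) (f j) ≡ adj Z2 i j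
    preserves 0F 0F = irref G p
    preserves 0F 1F = p~q
    preserves 0F 2F = p~r
    preserves 0F 3F = p~t
    preserves 0F 4F = p≁u
    preserves 1F 0F = ~-sym p~q
    preserves 1F 1F = irref G q
    preserves 1F 2F = q~r
    preserves 1F 3F = q≁t
    preserves 1F 4F = q≁u
    preserves 2F 0F = ~-sym p~r
    preserves 2F 1F = ~-sym q~r
    preserves 2F 2F = irref G r
    preserves 2F 3F = r≁t
    preserves 2F 4F = r≁u
    preserves 3F 0F = ~-sym p~t
    preserves 3F 1F = ≁-sym q≁t
    preserves 3F 2F = ≁-sym r≁t
    preserves 3F 3F = irref G t
    preserves 3F 4F = t~u
    preserves 4F 0F = ≁-sym p≁u
    preserves 4F 1F = ≁-sym q≁u
    preserves 4F 2F = ≁-sym r≁u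
    preserves 4F 3F = ~-sym t~u
    preserves 4F 4F = irref G u

  record Net : Set where
    field
      a b c x y z : V
      a~b : a ~ b
      b~c : b ~ c
      c~a : c ~ a
      a~x : a ~ x
      b~y : b ~ y
      c~z : c ~ z
      x≁b : x ≁ b
      x≁c : x ≁ c
      y≁c : y ≁ c
      y≁a : y ≁ a
      z≁a : z ≁ a
      z≁b : z ≁ b
      x≁y : x ≁ y
      y≁z : y ≁ z
      z≁x : z ≁ x

  rotate : Net → Net
  rotate N = record
    { a = b ; b = c ; c = a ; x = y ; y = z ; z = x
    ; a~b = b~c ; b~c = c~a ; c~a = a~b ; a~x = b~y ; b~y = c~z ; c~z = a~x
    ; x≁b = y≁c ; x≁c = y≁a ; y≁c = z≁a ; y≁a = z≁b ; z≁a = x≁b ; z≁b = x≁c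
    ; x≁y = y≁z ; y≁z = z≁x ; z≁x = x≁y }
    where open Net N

  net-of-copy : Contains G NetG → Net
  net-of-copy copy = record
    { a = f 0F ; b = f 1F ; c = f 2F ; x = f 3F ; y = f 4F ; z = f 5F
    ; a~b = e 0F 1F ; b~c = e 1F 2F ; c~a = e 2F 0F
    ; a~x = e 0F 3F ; b~y = e 1F 4F ; c~z = e 2F 5F
    ; x≁b = e 3F 1F ; x≁c = e 3F 2F ; y≁c = e 4F 2F ; y≁a = e 4F 0F
    ; z≁a = e 5F 0F ; z≁b = e 5F 1F
    ; x≁y = e 3F 4F ; y≁z = e 4F 5F ; z≁x = e 5F 3F }
    where
    open InducedSub copy renaming (emb to f; emb-adj to e)

module NetNeighbourhood (G : Graph) (claw-free : Free G K13) (Z2-free : Free G Z2)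
                        (N : Adjacency.Net G) where
  open Adjacency G
  open Net N

  Core Far Pendant : V → Set
  Core v = Near a v × Near b v × Near c v
  Far v = Apart a v × Apart b v × Apart c v
  Pendant v = v ≡ x ⊎ v ≡ y ⊎ v ≡ z

  core? : ∀ v → Dec (Core v)
  core? v = near? a v ×-dec near? b v ×-dec near? c v

  far⇒¬core : Far v → ¬ Core v
  far⇒¬core (apart , _) (near , _) = apart⇒¬near apart near

  a∈core : Core a
  a∈core = inj₁ refl , inj₂ (~-sym a~b) , inj₂ c~a

  x≢y : x ≢ y
  x≢y = ~≁⇒≢ a~x (≁-sym y≁a)

  x≢z : x ≢ z
  x≢z = ~≁⇒≢ a~x (≁-sym z≁a)

  y≢z : y ≢ z
  y≢z = ~≁⇒≢ b~y (≁-sym z≁b)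

  x≢b : x ≢ b
  x≢b = ≁~⇒≢ (≁-sym x≁c) (~-sym b~c)

  x≢c : x ≢ c
  x≢c = ≁~⇒≢ (≁-sym x≁b) b~c

  x∉core : ¬ Core x
  x∉core (_ , near-b , _) = apart⇒¬near (x≢b , ≁-sym x≁b) near-b

  pendants-no-common-neighbour : x ~ u → y ~ u → z ~ u → ⊥
  pendants-no-common-neighbour x~u y~u z~u =
    claw-free (induced-claw (~-sym x~u) (~-sym y~u) (~-sym z~u) x≁y (≁-sym z≁x) y≁z x≢y x≢z y≢z)

  no-vertex-sees-x-c-y : u ~ x → u ~ c → u ~ y → ⊥
  no-vertex-sees-x-c-y u~x u~c u~y =
    claw-free (induced-claw u~x u~c u~y x≁c x≁y (≁-sym y≁c) x≢c x≢y (~≁⇒≢ (~-sym c~a) (≁-sym y≁a)))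

  z-sees-neighbours-of-a-and-x : a ~ u → x ~ u → c ≁ u → z ~ u
  z-sees-neighbours-of-a-and-x a~u x~u c≁u = ¬≁⇒~ λ z≁u →
    Z2-free (induced-Z2 a~x x~u a~u (~-sym c~a) c~z x≁c (≁-sym c≁u) (≁-sym z≁a) (≁-sym z≁x) (≁-sym z≁u))

  no-vertex-sees-exactly-a-b : Near a u → Near b u → Apart c u → ⊥
  no-vertex-sees-exactly-a-b {u} near-a near-b (u≢c , c≁u) =
    pendants-no-common-neighbour x~u y~u (z-sees-neighbours-of-a-and-x a~u x~u c≁u)
    where
    a~u : a ~ u
    a~u = near⇒~ near-a (≁~⇒≢ c≁u c~a)
    b~u : b ~ u
    b~u = near⇒~ near-b (≁~⇒≢ c≁u (~-sym b~c))
    x~u : x ~ u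
    x~u = ¬≁⇒~ λ x≁u → claw-free (induced-claw a~x a~u (~-sym c~a) x≁u x≁c (≁-sym c≁u)
                                                (≁~⇒≢ (≁-sym x≁b) b~u) x≢c u≢c)
    y~u : y ~ u
    y~u = ¬≁⇒~ λ y≁u → claw-free (induced-claw b~y b~u b~c y≁u y≁c (≁-sym c≁u)
                                                (≁~⇒≢ (≁-sym y≁a) a~u) (≁~⇒≢ (≁-sym y≁a) (~-sym c~a)) u≢c)

  sees-only-a⇒x : Near a u → Apart b u → Apart c u → u ≡ x
  sees-only-a⇒x {u} near-a (u≢b , b≁u) (_ , c≁u) with u ≟ x
  ... | yes u≡x = u≡x
  ... | no u≢x = ⊥-elim (pendants-no-common-neighbour x~u y~u (z-sees-neighbours-of-a-and-x a~u x~u c≁u))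
    where
    a~u : a ~ u
    a~u = near⇒~ near-a (≁~⇒≢ b≁u (~-sym a~b))
    x~u : x ~ u
    x~u = ¬≁⇒~ λ x≁u → claw-free (induced-claw a~x a~u a~b x≁u x≁b (≁-sym b≁u) (u≢x ∘ sym) x≢b u≢b)
    y~u : y ~ u
    y~u = ¬≁⇒~ λ y≁u →
      Z2-free (induced-Z2 a~x x~u a~u a~b b~y x≁b (≁-sym b≁u) (≁-sym y≁a) x≁y (≁-sym y≁u))

  x-no-far-neighbour : x ~ w → Far w → ⊥
  x-no-far-neighbour x~w ((_ , a≁w) , (_ , b≁w) , (_ , c≁w)) =
    Z2-free (induced-Z2 a~b b~c (~-sym c~a) a~x x~w (≁-sym x≁b) (≁-sym x≁c) a≁w b≁w c≁w)

  core-not-adjacent-to-x-and-y : Core v → v ~ x → v ~ y → ⊥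
  core-not-adjacent-to-x-and-y (_ , _ , inj₁ refl) v~x _ = ~⇒¬≁ v~x (≁-sym x≁c)
  core-not-adjacent-to-x-and-y (_ , _ , inj₂ c~v) v~x v~y = no-vertex-sees-x-c-y v~x (~-sym c~v) v~y

  x≁far : Far w → x ≁ w
  x≁far far = ¬~⇒≁ λ x~w → x-no-far-neighbour x~w far

  core-not-adjacent-to-x-and-far : Core v → v ~ x → v ~ w → Far w → ⊥
  core-not-adjacent-to-x-and-far {v} (_ , near-b , _) v~x v~w far@((_ , a≁w) , (_ , b≁w) , _) =
    claw-free (induced-claw v~x v~b v~w x≁b (x≁far far) b≁w x≢b (~≁⇒≢ a~x a≁w) (~≁⇒≢ a~b a≁w))
    where
    v~b : v ~ b
    v~b = ~-sym (near⇒~ near-b (~≁⇒≢ (~-sym v~w) (≁-sym b≁w)))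

  no-core-far-far-path : Core v → v ~ w → Far w → w ~ t → Far t → ⊥
  no-core-far-far-path {v} {w} {t} core@(near-a , near-b , _) v~w far-w@((_ , a≁w) , (_ , b≁w) , _) w~t
                       far-t@((_ , a≁t) , (_ , b≁t) , _) =
    Z2-free (induced-Z2 v~w w~t (~-sym t~v) (~-sym a~v) a~x (≁-sym a≁w) (≁-sym a≁t) v≁x
                        (≁-sym (x≁far far-w)) (≁-sym (x≁far far-t)))
    where
    a~v : a ~ v
    a~v = near⇒~ near-a (~≁⇒≢ (~-sym v~w) (≁-sym a≁w))
    b~v : b ~ v
    b~v = near⇒~ near-b (~≁⇒≢ (~-sym v~w) (≁-sym b≁w))
    t~v : t ~ v
    t~v = ¬≁⇒~ λ t≁v →
      Z2-free (induced-Z2 (~-sym a~v) a~b (~-sym b~v) v~w w~t a≁w b≁w (≁-sym t≁v) a≁t b≁t)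
    v≁x : v ≁ x
    v≁x = ¬~⇒≁ λ v~x → core-not-adjacent-to-x-and-far core v~x v~w far-w

  x-sees-one-of : a ~ u → a ~ v → b ~ u → b ~ v → u ≁ v → u ≢ v → x ~ u ⊎ x ~ v
  x-sees-one-of {u} {v} a~u a~v b~u b~v u≁v u≢v with adj G x u ≟ᵇ true | adj G x v ≟ᵇ true
  ... | yes x~u | _ = inj₁ x~u
  ... | no _ | yes x~v = inj₂ x~v
  ... | no ¬x~u | no ¬x~v =
    ⊥-elim (claw-free (induced-claw a~x a~u a~v (¬~⇒≁ ¬x~u) (¬~⇒≁ ¬x~v) u≁v
                                    (≁~⇒≢ (≁-sym x≁b) b~u) (≁~⇒≢ (≁-sym x≁b) b~v) u≢v))

module NetStructure (G : Graph) (claw-free : Free G K13) (Z2-free : Free G Z2)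
                    (connected : Connected G) (N : Adjacency.Net G) where
  open Adjacency G
  open Net N
  open NetNeighbourhood G claw-free Z2-free N
  module R₁ = NetNeighbourhood G claw-free Z2-free (rotate N)
  module R₂ = NetNeighbourhood G claw-free Z2-free (rotate (rotate N))

  core₁ : Core v → R₁.Core v
  core₁ (near-a , near-b , near-c) = near-b , near-c , near-a

  core₂ : Core v → R₂.Core v
  core₂ (near-a , near-b , near-c) = near-c , near-a , near-b

  far₁ : Far v → R₁.Far v
  far₁ (apart-a , apart-b , apart-c) = apart-b , apart-c , apart-a

  far₂ : Far v → R₂.Far v
  far₂ (apart-a , apart-b , apart-c) = apart-c , apart-a , apart-b

  pendant-not-core : Pendant p → ¬ Core p
  pendant-not-core (inj₁ refl) = x∉core
  pendant-not-core (inj₂ (inj₁ refl)) = R₁.x∉core ∘ core₁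
  pendant-not-core (inj₂ (inj₂ refl)) = R₂.x∉core ∘ core₂

  pendant-no-far-neighbour : Pendant p → p ~ w → Far w → ⊥
  pendant-no-far-neighbour (inj₁ refl) p~w far = x-no-far-neighbour p~w far
  pendant-no-far-neighbour (inj₂ (inj₁ refl)) p~w far = R₁.x-no-far-neighbour p~w (far₁ far)
  pendant-no-far-neighbour (inj₂ (inj₂ refl)) p~w far = R₂.x-no-far-neighbour p~w (far₂ far)

  pendants-independent : Pendant p → Pendant q → p ~ q → ⊥
  pendants-independent (inj₁ refl) (inj₁ refl) p~q = ~-irrefl p~q refl
  pendants-independent (inj₁ refl) (inj₂ (inj₁ refl)) p~q = ~⇒¬≁ p~q x≁y
  pendants-independent (inj₁ refl) (inj₂ (inj₂ refl)) p~q = ~⇒¬≁ p~q (≁-sym z≁x)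
  pendants-independent (inj₂ (inj₁ refl)) (inj₁ refl) p~q = ~⇒¬≁ p~q (≁-sym x≁y)
  pendants-independent (inj₂ (inj₁ refl)) (inj₂ (inj₁ refl)) p~q = ~-irrefl p~q refl
  pendants-independent (inj₂ (inj₁ refl)) (inj₂ (inj₂ refl)) p~q = ~⇒¬≁ p~q y≁z
  pendants-independent (inj₂ (inj₂ refl)) (inj₁ refl) p~q = ~⇒¬≁ p~q z≁x
  pendants-independent (inj₂ (inj₂ refl)) (inj₂ (inj₁ refl)) p~q = ~⇒¬≁ p~q (≁-sym y≁z)
  pendants-independent (inj₂ (inj₂ refl)) (inj₂ (inj₂ refl)) p~q = ~-irrefl p~q refl

  outside-core : ¬ Core t → Far t ⊎ Pendant t
  outside-core {t} ¬core with near-or-apart a t | near-or-apart b t | near-or-apart c t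
  ... | inj₁ near-a | inj₁ near-b | inj₁ near-c = ⊥-elim (¬core (near-a , near-b , near-c))
  ... | inj₁ near-a | inj₁ near-b | inj₂ apart-c = ⊥-elim (no-vertex-sees-exactly-a-b near-a near-b apart-c)
  ... | inj₂ apart-a | inj₁ near-b | inj₁ near-c = ⊥-elim (R₁.no-vertex-sees-exactly-a-b near-b near-c apart-a)
  ... | inj₁ near-a | inj₂ apart-b | inj₁ near-c = ⊥-elim (R₂.no-vertex-sees-exactly-a-b near-c near-a apart-b)
  ... | inj₁ near-a | inj₂ apart-b | inj₂ apart-c = inj₂ (inj₁ (sees-only-a⇒x near-a apart-b apart-c))
  ... | inj₂ apart-a | inj₁ near-b | inj₂ apart-c = inj₂ (inj₂ (inj₁ (R₁.sees-only-a⇒x near-b apart-c apart-a)))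
  ... | inj₂ apart-a | inj₂ apart-b | inj₁ near-c = inj₂ (inj₂ (inj₂ (R₂.sees-only-a⇒x near-c apart-a apart-b)))
  ... | inj₂ apart-a | inj₂ apart-b | inj₂ apart-c = inj₁ (apart-a , apart-b , apart-c)

  core-far-path-ends-in-core : Core v → v ~ w → Far w → w ~ t → Core t
  core-far-path-ends-in-core {t = t} core v~w far-w w~t with core? t
  ... | yes core-t = core-t
  ... | no ¬core-t with outside-core ¬core-t
  ...   | inj₁ far-t = ⊥-elim (no-core-far-far-path core v~w far-w w~t far-t)
  ...   | inj₂ pendant-t = ⊥-elim (pendant-no-far-neighbour pendant-t (~-sym w~t) far-w)

  FarNeighboursInCore : V → Set
  FarNeighboursInCore u = Far u → ∀ {t} → u ~ t → Core t

  far-neighbours-in-core-step : FarNeighboursInCore u → u ~ v → FarNeighboursInCore v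
  far-neighbours-in-core-step {u} hyp u~v far-v v~t with core? u
  ... | yes core-u = core-far-path-ends-in-core core-u u~v far-v v~t
  ... | no ¬core-u with outside-core ¬core-u
  ...   | inj₁ far-u = ⊥-elim (far⇒¬core far-v (hyp far-u u~v))
  ...   | inj₂ pendant-u = ⊥-elim (pendant-no-far-neighbour pendant-u u~v far-v)

  far-neighbours-in-core-walk : Reach G u v → FarNeighboursInCore u → FarNeighboursInCore v
  far-neighbours-in-core-walk here hyp = hyp
  far-neighbours-in-core-walk (step u~v walk) hyp =
    far-neighbours-in-core-walk walk (far-neighbours-in-core-step hyp u~v)

  far-neighbours-in-core : Far w → w ~ t → Core t
  far-neighbours-in-core {w} far-w =
    far-neighbours-in-core-walk (connected a w) (λ far-a → ⊥-elim (far⇒¬core far-a a∈core)) far-w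

  outside-core-independent : ¬ Core u → ¬ Core w → u ~ w → ⊥
  outside-core-independent ¬core-u ¬core-w u~w with outside-core ¬core-u | outside-core ¬core-w
  ... | inj₁ far-u | _ = ¬core-w (far-neighbours-in-core far-u u~w)
  ... | inj₂ _ | inj₁ far-w = ¬core-u (far-neighbours-in-core far-w (~-sym u~w))
  ... | inj₂ pendant-u | inj₂ pendant-w = pendants-independent pendant-u pendant-w u~w

  core-not-adjacent-to-pendant-and-far : Core v → Pendant p → v ~ p → v ~ w → Far w → ⊥
  core-not-adjacent-to-pendant-and-far core (inj₁ refl) = core-not-adjacent-to-x-and-far core
  core-not-adjacent-to-pendant-and-far core (inj₂ (inj₁ refl)) v~p v~w far =
    R₁.core-not-adjacent-to-x-and-far (core₁ core) v~p v~w (far₁ far)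
  core-not-adjacent-to-pendant-and-far core (inj₂ (inj₂ refl)) v~p v~w far =
    R₂.core-not-adjacent-to-x-and-far (core₂ core) v~p v~w (far₂ far)

  core-not-adjacent-to-two-pendants : Core v → Pendant p → Pendant q → p ≢ q → v ~ p → v ~ q → ⊥
  core-not-adjacent-to-two-pendants core (inj₁ refl) (inj₁ refl) p≢q _ _ = p≢q refl
  core-not-adjacent-to-two-pendants core (inj₁ refl) (inj₂ (inj₁ refl)) _ v~x v~y =
    core-not-adjacent-to-x-and-y core v~x v~y
  core-not-adjacent-to-two-pendants core (inj₁ refl) (inj₂ (inj₂ refl)) _ v~x v~z =
    R₂.core-not-adjacent-to-x-and-y (core₂ core) v~z v~x
  core-not-adjacent-to-two-pendants core (inj₂ (inj₁ refl)) (inj₁ refl) _ v~y v~x =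
    core-not-adjacent-to-x-and-y core v~x v~y
  core-not-adjacent-to-two-pendants core (inj₂ (inj₁ refl)) (inj₂ (inj₁ refl)) p≢q _ _ = p≢q refl
  core-not-adjacent-to-two-pendants core (inj₂ (inj₁ refl)) (inj₂ (inj₂ refl)) _ v~y v~z =
    R₁.core-not-adjacent-to-x-and-y (core₁ core) v~y v~z
  core-not-adjacent-to-two-pendants core (inj₂ (inj₂ refl)) (inj₁ refl) _ v~z v~x =
    R₂.core-not-adjacent-to-x-and-y (core₂ core) v~z v~x
  core-not-adjacent-to-two-pendants core (inj₂ (inj₂ refl)) (inj₂ (inj₁ refl)) _ v~z v~y =
    R₁.core-not-adjacent-to-x-and-y (core₁ core) v~y v~z
  core-not-adjacent-to-two-pendants core (inj₂ (inj₂ refl)) (inj₂ (inj₂ refl)) p≢q _ _ = p≢q refl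

  core-outside-neighbour-unique : Core v → ¬ Core u → ¬ Core w → v ~ u → v ~ w → u ≡ w
  core-outside-neighbour-unique {v} {u} {w} core ¬core-u ¬core-w v~u v~w with u ≟ w
  ... | yes u≡w = u≡w
  ... | no u≢w with outside-core ¬core-u | outside-core ¬core-w
  ...   | inj₁ far-u@((u≢a , a≁u) , _) | inj₁ far-w@((w≢a , a≁w) , _) =
    ⊥-elim (claw-free (induced-claw v~u v~w v~a u≁w (≁-sym a≁u) (≁-sym a≁w) u≢w u≢a w≢a))
    where
    v~a : v ~ a
    v~a = ~-sym (near⇒~ (proj₁ core) (~≁⇒≢ (~-sym v~u) (≁-sym a≁u)))
    u≁w : u ≁ w
    u≁w = ¬~⇒≁ (¬core-w ∘ far-neighbours-in-core far-u)
  ...   | inj₁ far-u | inj₂ pendant-w =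
    ⊥-elim (core-not-adjacent-to-pendant-and-far core pendant-w v~w v~u far-u)
  ...   | inj₂ pendant-u | inj₁ far-w =
    ⊥-elim (core-not-adjacent-to-pendant-and-far core pendant-u v~u v~w far-w)
  ...   | inj₂ pendant-u | inj₂ pendant-w =
    ⊥-elim (core-not-adjacent-to-two-pendants core pendant-u pendant-w u≢w v~u v~w)

  common-neighbours-of-triangle-adjacent : a ~ u → b ~ u → c ~ u → a ~ v → b ~ v → c ~ v → u ≢ v → u ~ v
  common-neighbours-of-triangle-adjacent {u} {v} a~u b~u c~u a~v b~v c~v u≢v = ¬≁⇒~ λ u≁v →
    both-claws (x-sees-one-of a~u a~v b~u b~v u≁v u≢v)
               (R₁.x-sees-one-of b~u b~v c~u c~v u≁v u≢v)
               (R₂.x-sees-one-of c~u c~v a~u a~v u≁v u≢v)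
    where
    -- Two of the three pendants see the same vertex; together with the
    -- triangle vertex opposite to them they form a claw.
    both-claws : x ~ u ⊎ x ~ v → y ~ u ⊎ y ~ v → z ~ u ⊎ z ~ v → ⊥
    both-claws (inj₁ x~u) (inj₁ y~u) _ = no-vertex-sees-x-c-y (~-sym x~u) (~-sym c~u) (~-sym y~u)
    both-claws (inj₂ x~v) (inj₂ y~v) _ = no-vertex-sees-x-c-y (~-sym x~v) (~-sym c~v) (~-sym y~v)
    both-claws (inj₁ x~u) (inj₂ _) (inj₁ z~u) = R₂.no-vertex-sees-x-c-y (~-sym z~u) (~-sym b~u) (~-sym x~u)
    both-claws (inj₁ _) (inj₂ y~v) (inj₂ z~v) = R₁.no-vertex-sees-x-c-y (~-sym y~v) (~-sym a~v) (~-sym z~v)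
    both-claws (inj₂ _) (inj₁ y~u) (inj₁ z~u) = R₁.no-vertex-sees-x-c-y (~-sym y~u) (~-sym a~u) (~-sym z~u)
    both-claws (inj₂ x~v) (inj₁ _) (inj₂ z~v) = R₂.no-vertex-sees-x-c-y (~-sym z~v) (~-sym b~v) (~-sym x~v)

  core-clique : Core u → Core v → u ≢ v → u ~ v
  core-clique (inj₁ refl , _) (near-a , _) u≢v = near⇒~ near-a (u≢v ∘ sym)
  core-clique (_ , inj₁ refl , _) (_ , near-b , _) u≢v = near⇒~ near-b (u≢v ∘ sym)
  core-clique (_ , _ , inj₁ refl) (_ , _ , near-c) u≢v = near⇒~ near-c (u≢v ∘ sym)
  core-clique (near-a , _) (inj₁ refl , _) u≢v = ~-sym (near⇒~ near-a u≢v)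
  core-clique (_ , near-b , _) (_ , inj₁ refl , _) u≢v = ~-sym (near⇒~ near-b u≢v)
  core-clique (_ , _ , near-c) (_ , _ , inj₁ refl) u≢v = ~-sym (near⇒~ near-c u≢v)
  core-clique (inj₂ a~u , inj₂ b~u , inj₂ c~u) (inj₂ a~v , inj₂ b~v , inj₂ c~v) =
    common-neighbours-of-triangle-adjacent a~u b~u c~u a~v b~v c~v

module CombOfNet (G : Graph) (claw-free : Free G K13) (Z2-free : Free G Z2)
                 (connected : Connected G) (N : Adjacency.Net G) where
  open Adjacency G
  open Net N
  open NetNeighbourhood G claw-free Z2-free N
  open NetStructure G claw-free Z2-free connected N

  outside : List V
  outside = filter (¬? ∘ core?) (allFin (n G))

  leaf : Fin (length outside) → V
  leaf = lookup outside

  leaf-injective : Injective _≡_ _≡_ leaf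
  leaf-injective = lookup-injective (filter⁺ (¬? ∘ core?) (allFin⁺ (n G)))

  leaf∉core : ∀ i → ¬ Core (leaf i)
  leaf∉core i = proj₂ (∈-filter⁻ (¬? ∘ core?) {xs = allFin (n G)} (∈-lookup i))

  leaf-index : ¬ Core v → ∃ λ i → v ≡ leaf i
  leaf-index {v} ¬core = index v∈outside , lookup-index v∈outside
    where
    v∈outside : v ∈ outside
    v∈outside = ∈-filter⁺ (¬? ∘ core?) (∈-allFin v) ¬core

  injective-outside⇒≤ : ∀ {k} (f : Fin k → V) → Injective _≡_ _≡_ f → (∀ i → ¬ Core (f i)) →
                        k ≤ length outside
  injective-outside⇒≤ {k} f f-injective f∉core = injective⇒≤ {f = index-of} index-injective
    where
    index-of : Fin k → Fin (length outside)
    index-of i = proj₁ (leaf-index (f∉core i))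
    leaf-index-of : ∀ i → f i ≡ leaf (index-of i)
    leaf-index-of i = proj₂ (leaf-index (f∉core i))
    index-injective : Injective _≡_ _≡_ index-of
    index-injective {i} {j} e = f-injective (trans (leaf-index-of i) (trans (cong leaf e) (sym (leaf-index-of j))))

  pendant : Fin 3 → V
  pendant 0F = x
  pendant 1F = y
  pendant 2F = z

  pendant-is-pendant : ∀ i → Pendant (pendant i)
  pendant-is-pendant 0F = inj₁ refl
  pendant-is-pendant 1F = inj₂ (inj₁ refl)
  pendant-is-pendant 2F = inj₂ (inj₂ refl)

  pendant-injective : Injective _≡_ _≡_ pendant
  pendant-injective = distinct⇒injective pendant distinct
    where
    distinct : ∀ i j → i ≢ j → pendant i ≢ pendant j
    distinct 0F 1F _ = x≢y
    distinct 0F 2F _ = x≢z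
    distinct 1F 2F _ = y≢z
    distinct 1F 0F _ = x≢y ∘ sym
    distinct 2F 0F _ = x≢z ∘ sym
    distinct 2F 1F _ = y≢z ∘ sym
    distinct 0F 0F i≢j = ⊥-elim (i≢j refl)
    distinct 1F 1F i≢j = ⊥-elim (i≢j refl)
    distinct 2F 2F i≢j = ⊥-elim (i≢j refl)

  R : Fin (length outside) → V → Set
  R i v = leaf i ~ v × Core v

  first-step : Reach G u w → u ≢ w → ∃ (u ~_)
  first-step here u≢u = ⊥-elim (u≢u refl)
  first-step (step u~v _) _ = _ , u~v

  R-nonempty : ∀ i → ∃ (R i)
  R-nonempty i with first-step (connected (leaf i) a) (λ e → leaf∉core i (subst Core (sym e) a∈core))
  ... | v , leaf~v with core? v
  ...   | yes core-v = v , leaf~v , core-v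
  ...   | no ¬core-v = ⊥-elim (outside-core-independent (leaf∉core i) ¬core-v leaf~v)

  R-disjoint : ∀ i j v → R i v → R j v → i ≡ j
  R-disjoint i j v (i~v , core) (j~v , _) =
    leaf-injective (core-outside-neighbour-unique core (leaf∉core i) (leaf∉core j) (~-sym i~v) (~-sym j~v))

  core-witness : Fin (length outside) → V
  core-witness i = proj₁ (R-nonempty i)

  core-witness-injective : Injective _≡_ _≡_ core-witness
  core-witness-injective {i} {j} e =
    R-disjoint i j (core-witness i) (proj₂ (R-nonempty i)) (subst (R j) (sym e) (proj₂ (R-nonempty j)))

  cover : ∀ v → Core v ⊎ ∃ λ i → v ≡ leaf i
  cover v with core? v
  ... | yes core = inj₁ core
  ... | no ¬core = inj₂ (leaf-index ¬core)

  comb : PointedGenComb G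
  comb = record
    { m = length outside
    ; m≥3 = injective-outside⇒≤ pendant pendant-injective (pendant-not-core ∘ pendant-is-pendant)
    ; leaf = leaf
    ; leaf-inj = leaf-injective
    ; C = Core
    ; R = R
    ; cover = cover
    ; leaf∉C = leaf∉core
    ; C-size = core-witness , core-witness-injective , proj₂ ∘ proj₂ ∘ R-nonempty
    ; R⊆C = λ _ _ → proj₂
    ; R-ne = R-nonempty
    ; R-disj = R-disjoint
    ; C-clique = λ _ _ → core-clique
    ; L-indep = λ i j _ → ¬~⇒≁ (outside-core-independent (leaf∉core i) (leaf∉core j))
    ; L-C = λ _ _ core → mk⇔ (_, core) proj₁
    }

lemma2p1 : (G : Graph) → Connected G → Free G K13 → Free G Z2 → Contains G NetG
    → PointedGenComb G
lemma2p1 G connected claw-free Z2-free net =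
  CombOfNet.comb G claw-free Z2-free connected (Adjacency.net-of-copy G net)
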